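{- Let $\mathbb D=\langle D,\leq_{\mathbb D}\rangle$ be a directed set, $\mathbb I=\langle\langle G_q: q\in D\rangle,\langle h_{q,r}: q\leq_{\mathbb D} r\rangle\rangle$ an inverse system of groups over $\mathbb D$, and $\mathcal M_{\mathbb I}$ the structure described below. For an automorphism $\sigma$ of $\mathcal M_{\mathbb I}$ and $q\in D$, let $c_{\sigma,q}$ be the unique element of $G_q$ with $\sigma(\langle g,q,0\rangle)=\langle c_{\sigma,q}\cdot g,q,0\rangle$ for all $g\in G_q$. Then for every automorphism $\sigma$ of $\mathcal M_{\mathbb I}$ and all $q,r\in D$ with $q\leq_{\mathbb D} r$ we have $h_{q,r}(c_{\sigma,r})=c_{\sigma,q}$. In particular, $(c_{\sigma,q})_{q\in D}$ is an element of the inverse limit $G_{\mathbb I}$.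
   Context: A directed set is a set with a reflexive transitive relation in which any two elements have a common upper bound. An inverse system of groups over it consists of groups $G_q$ and homomorphisms $h_{q,r}:G_r\to G_q$ ($q\leq_{\mathbb D} r$) with $h_{q,q}=\mathrm{id}$ and $h_{q,r}\circ h_{r,s}=h_{q,s}$; its inverse limit is $G_{\mathbb I}=\{(g_q)_{q\in D}\in\prod_q G_q: h_{q,r}(g_r)=g_q\text{ for all }q\leq_{\mathbb D} r\}$. The first-order language $\mathcal L_{\mathbb I}$ has constant symbols $\dot c_{g,q}$ ($q\in D$, $g\in G_q$), unary relation symbols $\dot P_q$, binary relation symbols $\dot H_{q,r}$ ($q\leq_{\mathbb D} r$) and ternary relation symbols $\dot F_q$. The $\mathcal L_{\mathbb I}$-structure $\mathcal M_{\mathbb I}$ has domain $\{\langle g,q,i\rangle: q\in D, g\in G_q, i<2\}$, interprets $\dot c_{g,q}$ as $\langle g,q,1\rangle$, $\dot P_q$ as $\{\langle g,q,0\rangle: g\in G_q\}$, $\dot H_{q,r}$ as $\{(\langle g,r,0\rangle,\langle h_{q,r}(g),q,0\rangle): g\in G_r\}$, and $\dot F_q$ as $\{(\langle g,q,0\rangle,\langle h,q,1\rangle,\langle g\cdot h,q,0\rangle): g,h\in G_q\}$. (The element $c_{\sigma,q}$ exists and is unique.) -}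

module Defs where

open import Level using (Level; _⊔_) renaming (suc to lsuc)
open import Data.Product using (Σ; ∃; ∃-syntax; _×_; _,_)
open import Data.Fin using (Fin)
import Data.Fin as Fin
open import Function.Definitions using (Bijective)
open import Relation.Binary.PropositionalEquality using (_≡_)
open import Function.Bundles using (_⇔_)
open import Algebra.Core using (Op₁; Op₂)
import Algebra.Structures as AS

-- Since ≤ is a relation in the
-- set-theoretic sense, we require it to be proof-irrelevant.
record DirectedSet (a ℓ : Level) : Set (lsuc (a ⊔ ℓ)) where
  field
    Carrier    : Set a
    _≤_        : Carrier → Carrier → Set ℓ
    ≤-refl     : ∀ {q} → q ≤ q
    ≤-trans    : ∀ {q r s} → q ≤ r → r ≤ s → q ≤ s
    directed   : ∀ q r → ∃[ s ] (q ≤ s × r ≤ s)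
    ≤-irrelevant : ∀ {q r} (p p′ : q ≤ r) → p ≡ p′

record InverseSystem {a ℓ : Level} (𝔻 : DirectedSet a ℓ) (c : Level) : Set (a ⊔ ℓ ⊔ lsuc c) where
  open DirectedSet 𝔻
  field
    G       : Carrier → Set c
    _·_     : ∀ {q} → Op₂ (G q)
    e       : ∀ {q} → G q
    inv     : ∀ {q} → Op₁ (G q)
    isGroup : ∀ q → AS.IsGroup {A = G q} _≡_ _·_ e inv
    h       : ∀ {q r} → q ≤ r → G r → G q
    h-hom   : ∀ {q r} (p : q ≤ r) (x y : G r) → h p (x · y) ≡ h p x · h p y
    h-id    : ∀ {q} (g : G q) → h (≤-refl {q}) g ≡ g
    h-comp  : ∀ {q r s} (p : q ≤ r) (p′ : r ≤ s) (g : G s) →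
              h p (h p′ g) ≡ h (≤-trans p p′) g

module _ {a ℓ c : Level} {𝔻 : DirectedSet a ℓ} (𝕀 : InverseSystem 𝔻 c) where
  open DirectedSet 𝔻
  open InverseSystem 𝕀

  InInverseLimit : ((q : Carrier) → G q) → Set (a ⊔ ℓ ⊔ c)
  InInverseLimit g = ∀ {q r} (p : q ≤ r) → h p (g r) ≡ g q

  -- Domain of M_𝕀: triples ⟨g,q,i⟩ with q ∈ D, g ∈ G_q, i < 2,
  -- written  elt q g i.
  data Dom : Set (a ⊔ c) where
    elt : (q : Carrier) → G q → Fin 2 → Dom

  c^M : (q : Carrier) → G q → Dom
  c^M q g = elt q g (Fin.suc Fin.zero)

  P^M : Carrier → Dom → Set (a ⊔ c)
  P^M q x = ∃[ g ] (x ≡ elt q g Fin.zero)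

  H^M : ∀ {q r} → q ≤ r → Dom → Dom → Set (a ⊔ c)
  H^M {q} {r} p x y = ∃[ g ] (x ≡ elt r g Fin.zero × y ≡ elt q (h p g) Fin.zero)

  F^M : Carrier → Dom → Dom → Dom → Set (a ⊔ c)
  F^M q x y z = Σ (G q) λ g → Σ (G q) λ k →
    (x ≡ elt q g Fin.zero × y ≡ elt q k (Fin.suc Fin.zero) × z ≡ elt q (g · k) Fin.zero)

  record IsAutomorphism (σ : Dom → Dom) : Set (a ⊔ ℓ ⊔ c) where
    field
      bijective : Bijective {A = Dom} _≡_ _≡_ σ
      pres-c    : ∀ q (g : G q) → σ (c^M q g) ≡ c^M q g
      pres-P    : ∀ q x → P^M q x ⇔ P^M q (σ x)
      pres-H    : ∀ {q r} (p : q ≤ r) x y → H^M p x y ⇔ H^M p (σ x) (σ y)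
      pres-F    : ∀ q x y z → F^M q x y z ⇔ F^M q (σ x) (σ y) (σ z)

-- Since σ preserves the relation H_{q,r}, which
-- holds exactly of the pairs (⟨g,r,0⟩, ⟨h_{q,r}(g),q,0⟩), the image pair
-- (⟨c_r · g,r,0⟩, ⟨c_q · h_{q,r}(g),q,0⟩) is again an H_{q,r}-pair.  Reading
-- off the group components gives the equivariance law
--     h_{q,r}(c_r · g) = c_q · h_{q,r}(g)        for all g ∈ G_r.
-- Taking g = e and using that h_{q,r} is a homomorphism, the left-hand side is
-- h_{q,r}(c_r) · h_{q,r}(e); right cancellation of h_{q,r}(e) in G_q yields
-- h_{q,r}(c_r) = c_q, which is exactly membership of (c_q)_q in G_𝕀.
module Submission where

open import Defs
open import Level using (Level)
open import Data.Product using (_×_; _,_)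
open import Data.Fin using (Fin; zero)
open import Relation.Binary.PropositionalEquality using (_≡_; refl; sym; trans; cong; module ≡-Reasoning)
open import Function.Bundles using (Equivalence)
import Algebra.Properties.Group as GroupProperties

module _ {a ℓ c : Level} {𝔻 : DirectedSet a ℓ} (𝕀 : InverseSystem 𝔻 c) where
  open DirectedSet 𝔻
  open InverseSystem 𝕀

  elt-injective : ∀ {q} {x y : G q} {i j : Fin 2} →
                  _≡_ {A = Dom 𝕀} (elt q x i) (elt q y j) → x ≡ y
  elt-injective refl = refl

  ·-cancelʳ : ∀ q (z x y : G q) → x · z ≡ y · z → x ≡ y
  ·-cancelʳ q = GroupProperties.∙-cancelʳ (record { isGroup = isGroup q })

  module _ (σ : Dom 𝕀 → Dom 𝕀) (aut : IsAutomorphism 𝕀 σ)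
           (cσ : (q : Carrier) → G q)
           (σ-translates : ∀ q g → σ (elt q g zero) ≡ elt q (cσ q · g) zero) where

    -- σ commutes with the bonding maps: applying σ to the H_{q,r}-pair
    -- (⟨g,r,0⟩, ⟨h(g),q,0⟩) yields another H_{q,r}-pair.
    translation-equivariant : ∀ {q r} (p : q ≤ r) (g : G r) →
                              h p (cσ r · g) ≡ cσ q · h p g
    translation-equivariant {q} {r} p g
      with Equivalence.to (IsAutomorphism.pres-H aut p (elt r g zero) (elt q (h p g) zero))
                          (g , refl , refl)
    ... | g′ , σx≡ , σy≡ = begin
        h p (cσ r · g) ≡⟨ cong (h p) (elt-injective (trans (sym (σ-translates r g)) σx≡)) ⟩
        h p g′         ≡⟨ elt-injective (trans (sym σy≡) (σ-translates q (h p g))) ⟩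
        cσ q · h p g   ∎
      where open ≡-Reasoning

    translation-thread : ∀ {q r} (p : q ≤ r) → h p (cσ r) ≡ cσ q
    translation-thread {q} {r} p = ·-cancelʳ q (h p e) (h p (cσ r)) (cσ q) (begin
        h p (cσ r) · h p e ≡⟨ sym (h-hom p (cσ r) e) ⟩
        h p (cσ r · e)     ≡⟨ translation-equivariant p e ⟩
        cσ q · h p e       ∎)
      where open ≡-Reasoning

proposition2p10 : {a ℓ c : Level} {𝔻 : DirectedSet a ℓ} (𝕀 : InverseSystem 𝔻 c) →
    (σ : Dom 𝕀 → Dom 𝕀) → IsAutomorphism 𝕀 σ →
    (cσ : (q : DirectedSet.Carrier 𝔻) → InverseSystem.G 𝕀 q) →
    (∀ q g → σ (elt q g zero) ≡ elt q (InverseSystem._·_ 𝕀 (cσ q) g) zero) →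
    ((∀ {q r} (p : DirectedSet._≤_ 𝔻 q r) → InverseSystem.h 𝕀 p (cσ r) ≡ cσ q)
    × InInverseLimit 𝕀 cσ)
proposition2p10 𝕀 σ aut cσ σ-translates = thread , thread
  where
  thread : InInverseLimit 𝕀 cσ
  thread = translation-thread 𝕀 σ aut cσ σ-translates
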